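{- Let $n$ and $k$ be integers with $n-1>k\ge 1$, and let $G$ be a $k$-connected graph of order $n$. Then for every vertex $x$ of $G$, \[W(x,G)\le \tfrac{1}{2}\Big\lfloor \frac{n+k-2}{k}\Big\rfloor\Big(2n+k-2-k\Big\lfloor \frac{n+k-2}{k}\Big\rfloor\Big).\] Moreover, this bound is sharp when $k=1$ or $k\ge 2$ is even: in these cases there exist a $k$-connected graph $G$ of order $n$ and a vertex $x$ of $G$ for which equality holds.
   Context: All graphs are finite, simple and connected. A connected graph $G$ is $k$-connected if removing any $k-1$ vertices of $G$ leaves neither a disconnected graph nor a one-vertex graph. The order of $G$ is $|V(G)|$. For vertices $x,y$, $d_G(x,y)$ is the length of a shortest $x$–$y$ path, and the status of $x$ is $W(x,G)=\sum_{y\in V(G)} d_G(x,y)$. -}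

module Defs where

open import Data.Nat using (ℕ; zero; suc; _+_; _*_; _∸_; _≤_; _/_)
open import Data.Fin using (Fin)
open import Data.Fin.Subset using (Subset; _∉_; ∣_∣)
open import Data.Vec.Functional using (foldr)
open import Data.Product using (_×_)
open import Data.Empty using (⊥)
open import Data.Unit using (⊤)
open import Relation.Binary.PropositionalEquality using (_≡_)

record Graph (n : ℕ) : Set₁ where
  field
    Adj    : Fin n → Fin n → Set
    sym    : ∀ {x y} → Adj x y → Adj y x
    irrefl : ∀ {x} → Adj x x → ⊥
open Graph public

data WalkIn {n : ℕ} (G : Graph n) (P : Fin n → Set) : Fin n → Fin n → ℕ → Set where
  nil  : ∀ {x} → P x → WalkIn G P x x 0
  cons : ∀ {x y z m} → P x → Adj G x y → WalkIn G P y z m → WalkIn G P x z (suc m)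

Walk : ∀ {n} → Graph n → Fin n → Fin n → ℕ → Set
Walk G = WalkIn G (λ _ → ⊤)

ConnectedAvoiding : ∀ {n} → Graph n → Subset n → Set
ConnectedAvoiding G S = ∀ x y → x ∉ S → y ∉ S → Σ' x y
  where
  open import Data.Product using (∃)
  Σ' : _ → _ → Set
  Σ' x y = ∃ λ m → WalkIn G (λ v → v ∉ S) x y m

Connected : ∀ {n} → Graph n → Set
Connected G = ∀ x y → Data.Product.∃ λ m → Walk G x y m
  where import Data.Product

-- k-connected: G is connected, and removing any k-1 vertices leaves neither a
-- disconnected graph nor a one-vertex graph (i.e. at least 2 vertices remain).
KConnected : ∀ {n} → ℕ → Graph n → Set
KConnected {n} k G =
  Connected G × (k ∸ 1) + 2 ≤ n ×
  (∀ (S : Subset n) → ∣ S ∣ ≡ k ∸ 1 → ConnectedAvoiding G S)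

IsDistance : ∀ {n} → Graph n → (Fin n → Fin n → ℕ) → Set
IsDistance G d = ∀ x y → Walk G x y (d x y) × (∀ m → Walk G x y m → d x y ≤ m)

sumFin : ∀ {n} → (Fin n → ℕ) → ℕ
sumFin f = foldr _+_ 0 f

status : ∀ {n} → (Fin n → Fin n → ℕ) → Fin n → ℕ
status d x = sumFin (d x)

-- q = ⌊(n+k-2)/k⌋ (k ≥ 1 supplied as k = suc k').
quot : ℕ → ℕ → ℕ
quot n k' = (n + suc k' ∸ 2) / suc k'

-- Twice the bound: q (2n + k - 2 - k q)  (this quantity is ≥ n, so ∸ is exact).
twiceBound : ℕ → ℕ → ℕ
twiceBound n k' = quot n k' * (2 * n + suc k' ∸ 2 ∸ suc k' * quot n k')

-- Write dₓ = d x.  Summing by layers, W(x) = Σ_{t ≥ 0} #{v : dₓ v > t}.  Every x–y walk passes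
-- through each level {v : dₓ v = s} with 0 < s < dₓ y, so if some vertex lies beyond level t + 1,
-- that level has at least k vertices: otherwise, padded to k − 1 vertices other than x and y, it
-- would separate x from y.  Hence #{v : dₓ v > t} ≤ n − 1 − t k for every t, and summing these
-- bounds gives the theorem.  In the k-th power of the path 0, 1, …, n − 1 the distance from 0 to j
-- is ⌈j / k⌉, so vertex 0 attains every layer bound, and this graph is k-connected.

module Submission where

open import Data.Bool.Base using (Bool; true; false; not; _∧_; _∨_; T; if_then_else_)
open import Data.Bool.Properties using (T-∧; T-≡; T-not-≡)
open import Data.Empty using (⊥-elim)
open import Data.Fin using (Fin; zero; suc; toℕ; fromℕ<; _≟_)
open import Data.Fin.Properties using (toℕ-injective; toℕ<n; toℕ-fromℕ<)
open import Data.Fin.Subset using (Subset; _∈_; _∉_; ∣_∣; inside; outside)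
open import Data.Fin.Subset.Properties using (_∈?_)
open import Data.Nat using (ℕ; zero; suc; _+_; _*_; _∸_; _⊓_; ∣_-_∣; _≤_; _<_; z≤n; s≤s; s≤s⁻¹; z<s; _≤?_; _<ᵇ_; _≡ᵇ_)
open import Data.Nat.DivMod using (_/_; _%_; m/n*n≤m; m≡m%n+[m/n]*n; m%n<n; m/n≡1+[m∸n]/n)
open import Data.Nat.Properties renaming (_≟_ to _≟ℕ_)
open import Data.Nat.Solver using (module +-*-Solver)
open import Data.Product using (_×_; _,_; ∃; Σ; proj₁; proj₂)
open import Data.Sum using (_⊎_; inj₁; inj₂)
open import Data.Unit using (tt)
open import Data.Vec using ([]; _∷_; here; there)
open import Function using (_∘_; _$_)
open import Function.Bundles using (Equivalence)
open import Relation.Binary.PropositionalEquality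
  using (_≡_; _≢_; refl; sym; trans; cong; cong₂; subst; module ≡-Reasoning)
open import Relation.Nullary using (does; ¬_; yes; no)

open import Defs hiding (sym)
open +-*-Solver using (solve; _:+_; _:*_; _:=_; con)

private
  T-from≡ : ∀ {b} → b ≡ true → T b
  T-from≡ = Equivalence.from T-≡

  ¬T-from≡ : ∀ {b} → b ≡ false → ¬ T b
  ¬T-from≡ refl ()

  T-not⇒¬T : ∀ {b} → T (not b) → ¬ T b
  T-not⇒¬T = ¬T-from≡ ∘ Equivalence.to T-not-≡

count : ∀ {n} → (Fin n → Bool) → ℕ
count {zero}  p = 0
count {suc n} p = (if p zero then 1 else 0) + count (p ∘ suc)

count-mono : ∀ {n} {p q : Fin n → Bool} → (∀ i → T (p i) → T (q i)) → count p ≤ count q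
count-mono {zero}          p⇒q = z≤n
count-mono {suc n} {p} {q} p⇒q with p zero | q zero | p⇒q zero
... | true  | true  | _ = s≤s (count-mono (p⇒q ∘ suc))
... | true  | false | h = ⊥-elim (h tt)
... | false | true  | _ = m≤n⇒m≤1+n (count-mono (p⇒q ∘ suc))
... | false | false | _ = count-mono (p⇒q ∘ suc)

count-cong : ∀ {n} {p q : Fin n → Bool} →
  (∀ i → T (p i) → T (q i)) → (∀ i → T (q i) → T (p i)) → count p ≡ count q
count-cong p⇒q q⇒p = ≤-antisym (count-mono p⇒q) (count-mono q⇒p)

count-≗ : ∀ {n} {p q : Fin n → Bool} → (∀ i → p i ≡ q i) → count p ≡ count q
count-≗ p≗q = count-cong (λ i → subst T (p≗q i)) (λ i → subst T (sym (p≗q i)))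

count-split : ∀ {n} (p q : Fin n → Bool) →
  count p ≡ count (λ i → p i ∧ q i) + count (λ i → p i ∧ not (q i))
count-split {zero}  p q = refl
count-split {suc n} p q with p zero | q zero
... | true  | true  = cong suc (count-split (p ∘ suc) (q ∘ suc))
... | true  | false = trans (cong suc (count-split (p ∘ suc) (q ∘ suc))) (sym (+-suc _ _))
... | false | _     = count-split (p ∘ suc) (q ∘ suc)

count-complement : ∀ {n} (p : Fin n → Bool) → count p + count (not ∘ p) ≡ n
count-complement {zero}  p = refl
count-complement {suc n} p with p zero
... | true  = cong suc (count-complement (p ∘ suc))
... | false = trans (+-suc _ _) (cong suc (count-complement (p ∘ suc)))

count-∨ : ∀ {n} (p q : Fin n → Bool) → count (λ i → p i ∨ q i) ≤ count p + count q
count-∨ {zero}  p q = z≤n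
count-∨ {suc n} p q with p zero | q zero
... | true  | true  = s≤s (≤-trans (count-∨ (p ∘ suc) (q ∘ suc)) 
                                 (≤-trans (n≤1+n _) (≤-reflexive (sym (+-suc _ _)))))
... | true  | false = s≤s (count-∨ (p ∘ suc) (q ∘ suc))
... | false | true  = ≤-trans (s≤s (count-∨ (p ∘ suc) (q ∘ suc))) (≤-reflexive (sym (+-suc _ _)))
... | false | false = count-∨ (p ∘ suc) (q ∘ suc)

count-false : ∀ n → count {n} (λ _ → false) ≡ 0
count-false zero    = refl
count-false (suc n) = count-false n

count-true : ∀ n → count {n} (λ _ → true) ≡ n
count-true zero    = refl
count-true (suc n) = cong suc (count-true n)

∃⇒count-pos : ∀ {n} (p : Fin n → Bool) a → T (p a) → 1 ≤ count p
∃⇒count-pos p zero    pa with p zero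
... | true = s≤s z≤n
∃⇒count-pos p (suc a) pa = ≤-trans (∃⇒count-pos (p ∘ suc) a pa) (m≤n+m _ _)

count-miss : ∀ {n} (p : Fin n → Bool) a → T (not (p a)) → count p ≤ n ∸ 1
count-miss {n} p a ¬pa = begin
  count p                                      ≡⟨ sym (m+n∸n≡m (count p) (count (not ∘ p))) ⟩
  count p + count (not ∘ p) ∸ count (not ∘ p) ≡⟨ cong (_∸ count (not ∘ p)) (count-complement p) ⟩
  n ∸ count (not ∘ p)                          ≤⟨ ∸-monoʳ-≤ n (∃⇒count-pos (not ∘ p) a ¬pa) ⟩
  n ∸ 1                                        ∎
  where open ≤-Reasoning

count-pos⇒∃ : ∀ {n} (p : Fin n → Bool) → 1 ≤ count p → ∃ λ a → T (p a)
count-pos⇒∃ {suc n} p pos with p zero in eq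
... | true  = zero , T-from≡ eq
... | false = let a , pa = count-pos⇒∃ (p ∘ suc) pos in suc a , pa

count-excess : ∀ {n} (p q : Fin n → Bool) → count q < count p → ∃ λ a → T (p a) × T (not (q a))
count-excess p q q<p =
  let a , pa∧¬qa = count-pos⇒∃ p∧¬q p∧¬q-nonempty in a , Equivalence.to T-∧ pa∧¬qa
  where
  p∧¬q : _ → Bool
  p∧¬q i = p i ∧ not (q i)
  p∧q⊆q : ∀ i → T (p i ∧ q i) → T (q i)
  p∧q⊆q i = proj₂ ∘ Equivalence.to (T-∧ {p i})
  p∧¬q-nonempty : 1 ≤ count p∧¬q
  p∧¬q-nonempty = +-cancelˡ-≤ (count q) 1 _ $ begin
    count q + 1                              ≡⟨ +-comm (count q) 1 ⟩
    suc (count q)                            ≤⟨ q<p ⟩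
    count p                                  ≡⟨ count-split p q ⟩
    count (λ i → p i ∧ q i) + count p∧¬q     ≤⟨ +-monoˡ-≤ _ (count-mono p∧q⊆q) ⟩
    count q + count p∧¬q                     ∎
    where open ≤-Reasoning

count-≟ : ∀ {n} (x : Fin n) → count (λ v → does (v ≟ x)) ≤ 1
count-≟ {suc n} zero    = s≤s (≤-reflexive (count-false n))
count-≟         (suc x) = count-≟ x

distinctFrom : ∀ {n} → Fin n → Fin n → Fin n → Bool
distinctFrom x y v = not (does (v ≟ x) ∨ does (v ≟ y))

distinctFrom-sound : ∀ {n} (x y v : Fin n) → T (distinctFrom x y v) → v ≢ x × v ≢ y
distinctFrom-sound x y v v≢x,y with v ≟ x | v ≟ y
... | no v≢x | no v≢y = v≢x , v≢y
... | yes _  | _      = ⊥-elim v≢x,y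
... | no _   | yes _  = ⊥-elim v≢x,y

distinctFrom-complete : ∀ {n} (x y v : Fin n) → v ≢ x → v ≢ y → T (distinctFrom x y v)
distinctFrom-complete x y v v≢x v≢y with v ≟ x | v ≟ y
... | no _    | no _    = tt
... | yes v≡x | _       = ⊥-elim (v≢x v≡x)
... | no _    | yes v≡y = ⊥-elim (v≢y v≡y)

count-distinctFrom : ∀ {n} (x y : Fin n) → n ∸ 2 ≤ count (distinctFrom x y)
count-distinctFrom {n} x y = begin
  n ∸ 2                                                ≤⟨ ∸-monoʳ-≤ n ∣x-or-y∣≤2 ⟩
  n ∸ count x-or-y                                     ≡⟨ cong (_∸ count x-or-y) (sym (count-complement x-or-y)) ⟩
  count x-or-y + count (not ∘ x-or-y) ∸ count x-or-y   ≡⟨ m+n∸m≡n (count x-or-y) _ ⟩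
  count (distinctFrom x y)                             ∎
  where
  open ≤-Reasoning
  x-or-y : Fin _ → Bool
  x-or-y v = does (v ≟ x) ∨ does (v ≟ y)
  ∣x-or-y∣≤2 : count x-or-y ≤ 2
  ∣x-or-y∣≤2 = ≤-trans (count-∨ (λ v → does (v ≟ x)) (λ v → does (v ≟ y)))
                       (+-mono-≤ (count-≟ x) (count-≟ y))

count-toℕ> : ∀ n m → count {n} (λ y → m <ᵇ toℕ y) ≡ n ∸ suc m
count-toℕ> zero    m       = refl
count-toℕ> (suc n) zero    = count-true n
count-toℕ> (suc n) (suc m) = count-toℕ> n m

count-toℕ≤ : ∀ {n m} → m < n → count {n} (λ y → not (m <ᵇ toℕ y)) ≡ suc m
count-toℕ≤ {suc n} {zero}  _        = cong suc (count-false n)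
count-toℕ≤ {suc n} {suc m} (s≤s m<n) = cong suc (count-toℕ≤ m<n)

count-window : ∀ {n} i k → i + k < n → count {n} (λ y → (i <ᵇ toℕ y) ∧ not (i + k <ᵇ toℕ y)) ≡ k
count-window {suc n} zero    zero    _           = count-false n
count-window {suc n} zero    (suc k) (s≤s k<n)   = count-toℕ≤ k<n
count-window {suc n} (suc i) k       (s≤s i+k<n) = count-window i k i+k<n

∣S∣≡count : ∀ {n} (S : Subset n) → ∣ S ∣ ≡ count (λ v → does (v ∈? S))
∣S∣≡count []          = refl
∣S∣≡count (true  ∷ S) = cong suc (∣S∣≡count S)
∣S∣≡count (false ∷ S) = ∣S∣≡count S

∈⇒T : ∀ {n} {x : Fin n} {S : Subset n} → x ∈ S → T (does (x ∈? S))
∈⇒T {x = x} {S} x∈S with x ∈? S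
... | yes _   = tt
... | no  x∉S = x∉S x∈S

SubsetBetween : ∀ {n} → (Fin n → Bool) → (Fin n → Bool) → ℕ → Set
SubsetBetween {n} p q m =
  Σ (Subset n) λ S → (∀ i → T (p i) → i ∈ S) × (∀ i → i ∈ S → T (q i)) × ∣ S ∣ ≡ m

private
  cons-inside : ∀ {n} {p q : Fin (suc n) → Bool} {m} → T (q zero) →
    SubsetBetween (p ∘ suc) (q ∘ suc) m → SubsetBetween p q (suc m)
  cons-inside q₀ (S , p⊆S , S⊆q , ∣S∣≡m) =
    inside ∷ S ,
    (λ { zero _ → here ; (suc i) pᵢ → there (p⊆S i pᵢ) }) ,
    (λ { zero _ → q₀ ; (suc i) (there i∈S) → S⊆q i i∈S }) ,
    cong suc ∣S∣≡m

  cons-outside : ∀ {n} {p q : Fin (suc n) → Bool} {m} → ¬ T (p zero) →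
    SubsetBetween (p ∘ suc) (q ∘ suc) m → SubsetBetween p q m
  cons-outside ¬p₀ (S , p⊆S , S⊆q , ∣S∣≡m) =
    outside ∷ S ,
    (λ { zero p₀ → ⊥-elim (¬p₀ p₀) ; (suc i) pᵢ → there (p⊆S i pᵢ) }) ,
    (λ { zero () ; (suc i) (there i∈S) → S⊆q i i∈S }) ,
    ∣S∣≡m

subset-between : ∀ {n} (p q : Fin n → Bool) m → (∀ i → T (p i) → T (q i)) →
  count p ≤ m → m ≤ count q → SubsetBetween p q m
subset-between {zero} p q zero _ _ z≤n = [] , (λ ()) , (λ _ ()) , refl
subset-between {suc n} p q m p⇒q lo hi with p zero in p₀ | q zero in q₀
... | true | false = ⊥-elim (¬T-from≡ q₀ (p⇒q zero (T-from≡ p₀)))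
subset-between {suc n} p q (suc m) p⇒q (s≤s lo) (s≤s hi) | true | true =
  cons-inside (T-from≡ q₀) (subset-between (p ∘ suc) (q ∘ suc) m (p⇒q ∘ suc) lo hi)
... | false | false = cons-outside (¬T-from≡ p₀) (subset-between (p ∘ suc) (q ∘ suc) m (p⇒q ∘ suc) lo hi)
... | false | true with m ≤? count (q ∘ suc)
...   | yes m≤ = cons-outside (¬T-from≡ p₀) (subset-between (p ∘ suc) (q ∘ suc) m (p⇒q ∘ suc) lo m≤)
...   | no  m≰ = subst (SubsetBetween p q) (≤-antisym (≰⇒> m≰) hi)
  (cons-inside (T-from≡ q₀)
    (subset-between (p ∘ suc) (q ∘ suc) _ (p⇒q ∘ suc) (count-mono (p⇒q ∘ suc)) ≤-refl))

sumBelow : ℕ → (ℕ → ℕ) → ℕ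
sumBelow zero    g = 0
sumBelow (suc m) g = sumBelow m g + g m

sumBelow-cong : ∀ m {g h : ℕ → ℕ} → (∀ t → g t ≡ h t) → sumBelow m g ≡ sumBelow m h
sumBelow-cong zero    g≡h = refl
sumBelow-cong (suc m) g≡h = cong₂ _+_ (sumBelow-cong m g≡h) (g≡h m)

sumBelow-mono : ∀ m {g h : ℕ → ℕ} → (∀ t → g t ≤ h t) → sumBelow m g ≤ sumBelow m h
sumBelow-mono zero    g≤h = z≤n
sumBelow-mono (suc m) g≤h = +-mono-≤ (sumBelow-mono m g≤h) (g≤h m)

sumBelow-+ : ∀ m (g h : ℕ → ℕ) → sumBelow m (λ t → g t + h t) ≡ sumBelow m g + sumBelow m h
sumBelow-+ zero    g h = refl
sumBelow-+ (suc m) g h rewrite sumBelow-+ m g h = +-assoc-swap (sumBelow m g) (sumBelow m h) (g m) (h m)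
  where
  +-assoc-swap : ∀ a b c d → (a + b) + (c + d) ≡ (a + c) + (b + d)
  +-assoc-swap a b c d = solve 4 (λ a b c d → (a :+ b) :+ (c :+ d) := (a :+ c) :+ (b :+ d)) refl a b c d

sumBelow-zero : ∀ m → sumBelow m (λ _ → 0) ≡ 0
sumBelow-zero zero    = refl
sumBelow-zero (suc m) = cong (_+ 0) (sumBelow-zero m)

sumBelow-truncate : ∀ m q (g : ℕ → ℕ) → q ≤ m → (∀ t → q ≤ t → g t ≡ 0) → sumBelow m g ≡ sumBelow q g
sumBelow-truncate m q g q≤m g-vanishes with m≤n⇒m<n∨m≡n q≤m
sumBelow-truncate m       q g q≤m g-vanishes | inj₂ refl = refl
sumBelow-truncate (suc m) q g q≤m g-vanishes | inj₁ q<1+m = begin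
  sumBelow m g + g m ≡⟨ cong (sumBelow m g +_) (g-vanishes m (s≤s⁻¹ q<1+m)) ⟩
  sumBelow m g + 0   ≡⟨ +-identityʳ _ ⟩
  sumBelow m g       ≡⟨ sumBelow-truncate m q g (s≤s⁻¹ q<1+m) g-vanishes ⟩
  sumBelow q g       ∎
  where open ≡-Reasoning

sumBelow-indicator : ∀ m a → sumBelow m (λ t → if t <ᵇ a then 1 else 0) ≡ m ⊓ a
sumBelow-indicator zero    a = refl
sumBelow-indicator (suc m) a rewrite sumBelow-indicator m a with m <ᵇ a in m<ᵇa
... | true  = let m<a = <ᵇ⇒< m a (T-from≡ m<ᵇa) in
  trans (cong (_+ 1) (m≤n⇒m⊓n≡m (<⇒≤ m<a))) (trans (+-comm m 1) (sym (m≤n⇒m⊓n≡m m<a)))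
... | false = let a≤m = ≮⇒≥ (¬T-from≡ m<ᵇa ∘ <⇒<ᵇ) in
  trans (cong (_+ 0) (m≥n⇒m⊓n≡n a≤m)) (trans (+-identityʳ a) (sym (m≥n⇒m⊓n≡n (m≤n⇒m≤1+n a≤m))))

layer-cake : ∀ {n} (f : Fin n → ℕ) m → (∀ y → f y ≤ m) →
  sumFin f ≡ sumBelow m (λ t → count (λ y → t <ᵇ f y))
layer-cake {zero}  f m f≤m = sym (sumBelow-zero m)
layer-cake {suc n} f m f≤m = begin
  f zero + sumFin (f ∘ suc)
    ≡⟨ cong₂ _+_ (sym (trans (sumBelow-indicator m (f zero)) (m≥n⇒m⊓n≡n (f≤m zero))))
                 (layer-cake (f ∘ suc) m (f≤m ∘ suc)) ⟩
  sumBelow m (λ t → if t <ᵇ f zero then 1 else 0) + sumBelow m (λ t → count (λ y → t <ᵇ f (suc y)))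
    ≡⟨ sym (sumBelow-+ m _ _) ⟩
  sumBelow m (λ t → count (λ y → t <ᵇ f y)) ∎
  where open ≡-Reasoning

⌈_/suc_⌉ : ℕ → ℕ → ℕ
⌈ m /suc k' ⌉ = (m + k') / suc k'

<⌈/⌉⇒*< : ∀ {m t} k' → t < ⌈ m /suc k' ⌉ → t * suc k' < m
<⌈/⌉⇒*< {m} {t} k' t<⌈m/k⌉ = +-cancelʳ-< k' (t * suc k') m $ begin-strict
  t * suc k' + k'       <⟨ ≤-reflexive (cong suc (+-comm (t * suc k') k')) ⟩
  suc t * suc k'        ≤⟨ *-monoˡ-≤ (suc k') t<⌈m/k⌉ ⟩
  ⌈ m /suc k' ⌉ * suc k' ≤⟨ m/n*n≤m (m + k') (suc k') ⟩
  m + k'                ∎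
  where open ≤-Reasoning

*<⇒<⌈/⌉ : ∀ {m t} k' → t * suc k' < m → t < ⌈ m /suc k' ⌉
*<⇒<⌈/⌉ {m} {t} k' tk<m = s≤s⁻¹ $ *-cancelʳ-< (suc k') (suc t) (suc ⌈ m /suc k' ⌉) $ begin-strict
  suc t * suc k'                                ≡⟨ sym (+-suc k' (t * suc k')) ⟩
  k' + suc (t * suc k')                         ≤⟨ +-monoʳ-≤ k' tk<m ⟩
  k' + m                                        ≡⟨ +-comm k' m ⟩
  m + k'                                        ≡⟨ m≡m%n+[m/n]*n (m + k') (suc k') ⟩
  (m + k') % suc k' + ⌈ m /suc k' ⌉ * suc k'    <⟨ +-monoˡ-< _ (m%n<n (m + k') (suc k')) ⟩
  suc ⌈ m /suc k' ⌉ * suc k'                    ∎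
  where open ≤-Reasoning

⌈/⌉-least : ∀ {m l} k' → m ≤ l * suc k' → ⌈ m /suc k' ⌉ ≤ l
⌈/⌉-least k' m≤lk = ≮⇒≥ (λ l<⌈m/k⌉ → <⇒≱ (<⌈/⌉⇒*< k' l<⌈m/k⌉) m≤lk)

⌈/⌉-step : ∀ {m} k' → suc k' ≤ m → ⌈ m /suc k' ⌉ ≡ suc ⌈ m ∸ suc k' /suc k' ⌉
⌈/⌉-step {m} k' k≤m = trans (m/n≡1+[m∸n]/n (≤-trans k≤m (m≤m+n m k')))
                             (cong (λ z → suc (z / suc k')) (+-∸-comm k' k≤m))

sumBelow-arith : ∀ a k q → (∀ t → t < q → t * k ≤ a) →
  2 * sumBelow q (λ t → a ∸ t * k) + q * q * k ≡ q * (2 * a + k)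
sumBelow-arith a k zero    _       = refl
sumBelow-arith a k (suc q) below-a = begin
  2 * (s + e) + suc q * suc q * k
    ≡⟨ solve 4 (λ s e q k → con 2 :* (s :+ e) :+ (con 1 :+ q) :* (con 1 :+ q) :* k
                 := (con 2 :* s :+ q :* q :* k) :+ (con 2 :* e :+ con 2 :* q :* k :+ k)) refl s e q k ⟩
  (2 * s + q * q * k) + (2 * e + 2 * q * k + k)
    ≡⟨ cong (_+ (2 * e + 2 * q * k + k)) (sumBelow-arith a k q (λ t t<q → below-a t (m≤n⇒m≤1+n t<q))) ⟩
  q * (2 * a + k) + (2 * e + 2 * q * k + k)
    ≡⟨ cong (λ z → q * (2 * z + k) + (2 * e + 2 * q * k + k)) (sym e+qk≡a) ⟩
  q * (2 * (e + q * k) + k) + (2 * e + 2 * q * k + k)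
    ≡⟨ solve 3 (λ e q k → q :* (con 2 :* (e :+ q :* k) :+ k) :+ (con 2 :* e :+ con 2 :* q :* k :+ k)
                 := (con 1 :+ q) :* (con 2 :* (e :+ q :* k) :+ k)) refl e q k ⟩
  suc q * (2 * (e + q * k) + k)
    ≡⟨ cong (λ z → suc q * (2 * z + k)) e+qk≡a ⟩
  suc q * (2 * a + k) ∎
  where
  open ≡-Reasoning
  s = sumBelow q (λ t → a ∸ t * k)
  e = a ∸ q * k
  e+qk≡a : e + q * k ≡ a
  e+qk≡a = m∸n+n≡m (below-a q ≤-refl)

twiceBound≡sumBelow : ∀ a k' → twiceBound (suc a) k' ≡ 2 * sumBelow (suc a) (λ t → a ∸ t * suc k')
twiceBound≡sumBelow a k' = sym $ begin
  2 * sumBelow (suc a) (λ t → a ∸ t * k)  ≡⟨ cong (2 *_) (sumBelow-truncate (suc a) q _ q≤1+a vanishes) ⟩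
  2 * s                                  ≡⟨ sym (m+n∸n≡m (2 * s) (q * q * k)) ⟩
  2 * s + q * q * k ∸ q * q * k          ≡⟨ cong₂ _∸_ (sumBelow-arith a k q below) (*-assoc q q k) ⟩
  q * (2 * a + k) ∸ q * (q * k)          ≡⟨ sym (*-distribˡ-∸ q (2 * a + k) (q * k)) ⟩
  q * (2 * a + k ∸ q * k)                ≡⟨ cong (λ z → q * (z ∸ q * k)) (sym 2n+k-2≡2a+k) ⟩
  q * (2 * suc a + k ∸ 2 ∸ q * k)        ≡⟨ cong (λ z → q * (2 * suc a + k ∸ 2 ∸ z)) (*-comm q k) ⟩
  q * (2 * suc a + k ∸ 2 ∸ k * q)        ≡⟨ cong (λ z → z * (2 * suc a + k ∸ 2 ∸ k * z)) (sym quot≡q) ⟩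
  twiceBound (suc a) k'                  ∎
  where
  open ≡-Reasoning
  k = suc k'
  q = ⌈ a /suc k' ⌉
  s = sumBelow q (λ t → a ∸ t * k)
  quot≡q : quot (suc a) k' ≡ q
  quot≡q = cong (λ z → (z ∸ 1) / k) (+-suc a k')
  below : ∀ t → t < q → t * k ≤ a
  below t = <⇒≤ ∘ <⌈/⌉⇒*< k'
  vanishes : ∀ t → q ≤ t → a ∸ t * k ≡ 0
  vanishes t q≤t = m≤n⇒m∸n≡0 (≮⇒≥ (λ tk<a → <⇒≱ (*<⇒<⌈/⌉ k' tk<a) q≤t))
  q≤1+a : q ≤ suc a
  q≤1+a = m≤n⇒m≤1+n (⌈/⌉-least k' (m≤m*n a k))
  2n+k-2≡2a+k : 2 * suc a + k ∸ 2 ≡ 2 * a + k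
  2n+k-2≡2a+k = cong (_∸ 2) (solve 2 (λ a k → con 2 :* (con 1 :+ a) :+ k := con 2 :+ (con 2 :* a :+ k)) refl a k)

module _ {n} {G : Graph n} {P : Fin n → Set} where

  walk-snoc : ∀ {x y z m} → WalkIn G P x y m → Adj G y z → P z → WalkIn G P x z (suc m)
  walk-snoc (nil px)        y~z pz = cons px y~z (nil pz)
  walk-snoc (cons px x~w w) y~z pz = cons px x~w (walk-snoc w y~z pz)

  walk-reverse : ∀ {x y m} → WalkIn G P x y m → WalkIn G P y x m
  walk-reverse (nil px)        = nil px
  walk-reverse (cons px x~w w) = walk-snoc (walk-reverse w) (Graph.sym G x~w) px

  walk-intermediate-value : (g : Fin n → ℕ) → (∀ {a b} → Adj G a b → g b ≤ suc (g a)) →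
    ∀ {u y m} t → WalkIn G P u y m → g u ≤ t → t < g y → ∃ λ v → P v × g v ≡ t
  walk-intermediate-value g g-edge t (nil _) gu≤t t<gu = ⊥-elim (<⇒≱ t<gu gu≤t)
  walk-intermediate-value g g-edge {u} t (cons pu u~w w) gu≤t t<gy with g u ≟ℕ t
  ... | yes gu≡t = u , pu , gu≡t
  ... | no  gu≢t = walk-intermediate-value g g-edge t w (≤-trans (g-edge u~w) (≤∧≢⇒< gu≤t gu≢t)) t<gy

walk-weaken : ∀ {n} {G : Graph n} {P Q : Fin n → Set} → (∀ v → P v → Q v) →
  ∀ {x y m} → WalkIn G P x y m → WalkIn G Q x y m
walk-weaken P⇒Q (nil px)        = nil (P⇒Q _ px)
walk-weaken P⇒Q (cons px x~w w) = cons (P⇒Q _ px) x~w (walk-weaken P⇒Q w)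

walk-avoiding : ∀ {n k'} {G : Graph n} → KConnected (suc k') G → (L : Fin n → Bool) → count L ≤ k' →
  ∀ x y → ¬ T (L x) → ¬ T (L y) → ∃ λ m → WalkIn G (λ v → ¬ T (L v)) x y m
walk-avoiding {n} {k'} (_ , k'+2≤n , connected-avoiding) L ∣L∣≤k' x y x∉L y∉L =
  proj₁ walk , walk-weaken (λ v v∉S Lv → v∉S (L⊆S v Lv)) (proj₂ walk)
  where
  L⊆distinct : ∀ v → T (L v) → T (distinctFrom x y v)
  L⊆distinct v Lv = distinctFrom-complete x y v (λ { refl → x∉L Lv }) (λ { refl → y∉L Lv })
  k'≤∣distinct∣ : k' ≤ count (distinctFrom x y)
  k'≤∣distinct∣ = begin
    k'                        ≡⟨ sym (m+n∸n≡m k' 2) ⟩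
    k' + 2 ∸ 2                ≤⟨ ∸-monoˡ-≤ 2 k'+2≤n ⟩
    n ∸ 2                     ≤⟨ count-distinctFrom x y ⟩
    count (distinctFrom x y)  ∎
    where open ≤-Reasoning
  padded = subset-between L (distinctFrom x y) k' L⊆distinct ∣L∣≤k' k'≤∣distinct∣
  S = proj₁ padded
  L⊆S = proj₁ (proj₂ padded)
  S⊆distinct = proj₁ (proj₂ (proj₂ padded))
  x∉S : x ∉ S
  x∉S x∈S = proj₁ (distinctFrom-sound x y x (S⊆distinct x x∈S)) refl
  y∉S : y ∉ S
  y∉S y∈S = proj₂ (distinctFrom-sound x y y (S⊆distinct y y∈S)) refl
  walk = connected-avoiding S (proj₂ (proj₂ (proj₂ padded))) x y x∉S y∉S

module _ {n} {G : Graph n} {d : Fin n → Fin n → ℕ} (d-dist : IsDistance G d) where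

  dist-self : ∀ x → d x x ≡ 0
  dist-self x = n≤0⇒n≡0 (proj₂ (d-dist x x) 0 (nil tt))

  dist-edge : ∀ x {a b} → Adj G a b → d x b ≤ suc (d x a)
  dist-edge x {a} {b} a~b = proj₂ (d-dist x b) _ (walk-snoc (proj₁ (d-dist x a)) a~b tt)

<ᵇ-∧-suc : ∀ t m → (t <ᵇ m) ∧ (suc t <ᵇ m) ≡ (suc t <ᵇ m)
<ᵇ-∧-suc zero    zero    = refl
<ᵇ-∧-suc zero    (suc m) = refl
<ᵇ-∧-suc (suc t) zero    = refl
<ᵇ-∧-suc (suc t) (suc m) = <ᵇ-∧-suc t m

<ᵇ-∧-not-suc : ∀ t m → (t <ᵇ m) ∧ not (suc t <ᵇ m) ≡ (m ≡ᵇ suc t)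
<ᵇ-∧-not-suc zero    zero          = refl
<ᵇ-∧-not-suc zero    (suc zero)    = refl
<ᵇ-∧-not-suc zero    (suc (suc m)) = refl
<ᵇ-∧-not-suc (suc t) zero          = refl
<ᵇ-∧-not-suc (suc t) (suc m)       = <ᵇ-∧-not-suc t m

module StatusBound {n} (G : Graph n) (k' : ℕ) (k-conn : KConnected (suc k') G)
                   (d : Fin n → Fin n → ℕ) (d-dist : IsDistance G d) (x : Fin n) where

  k : ℕ
  k = suc k'

  level : ℕ → Fin n → Bool
  level t v = d x v ≡ᵇ t

  above : ℕ → ℕ
  above t = count (λ v → t <ᵇ d x v)

  level-size : ∀ t y → suc t < d x y → k ≤ count (level (suc t))
  level-size t y 1+t<dxy with k ≤? count (level (suc t))
  ... | yes k≤ = k≤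
  ... | no  k≰ = ⊥-elim (v∉level (≡⇒≡ᵇ (d x v) (suc t) dxv≡1+t))
    where
    x∉level : ¬ T (level (suc t) x)
    x∉level lx = 0≢1+n (trans (sym (dist-self d-dist x)) (≡ᵇ⇒≡ (d x x) (suc t) lx))
    y∉level : ¬ T (level (suc t) y)
    y∉level ly = <-irrefl (sym (≡ᵇ⇒≡ (d x y) (suc t) ly)) 1+t<dxy
    walk = proj₂ (walk-avoiding k-conn (level (suc t)) (s≤s⁻¹ (≰⇒> k≰)) x y x∉level y∉level)
    crossing = walk-intermediate-value (d x) (dist-edge d-dist x) (suc t) walk
                 (≤-trans (≤-reflexive (dist-self d-dist x)) z≤n) 1+t<dxy
    v = proj₁ crossing
    v∉level = proj₁ (proj₂ crossing)
    dxv≡1+t = proj₂ (proj₂ crossing)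

  above-split : ∀ t → above t ≡ above (suc t) + count (level (suc t))
  above-split t = begin
    above t
      ≡⟨ count-split (λ v → t <ᵇ d x v) (λ v → suc t <ᵇ d x v) ⟩
    count (λ v → (t <ᵇ d x v) ∧ (suc t <ᵇ d x v)) + count (λ v → (t <ᵇ d x v) ∧ not (suc t <ᵇ d x v))
      ≡⟨ cong₂ _+_ (count-≗ (λ v → <ᵇ-∧-suc t (d x v))) (count-≗ (λ v → <ᵇ-∧-not-suc t (d x v))) ⟩
    above (suc t) + count (level (suc t)) ∎
    where open ≡-Reasoning

  above-bound : ∀ t → above t ≤ n ∸ suc (t * k)
  above-bound zero = count-miss _ x (subst (λ z → T (not (0 <ᵇ z))) (sym (dist-self d-dist x)) tt)
  above-bound (suc t) with 1 ≤? above (suc t)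
  ... | no  ¬pos = ≤-trans (≮⇒≥ ¬pos) z≤n
  ... | yes pos  = begin
    above (suc t)                      ≡⟨ sym (m+n∸n≡m (above (suc t)) ∣level∣) ⟩
    above (suc t) + ∣level∣ ∸ ∣level∣  ≡⟨ cong (_∸ ∣level∣) (sym (above-split t)) ⟩
    above t ∸ ∣level∣                  ≤⟨ ∸-mono (above-bound t) (level-size t y (<ᵇ⇒< (suc t) (d x y) 1+t<ᵇdxy)) ⟩
    n ∸ suc (t * k) ∸ k                ≡⟨ ∸-+-assoc n (suc (t * k)) k ⟩
    n ∸ suc (t * k + k)                ≡⟨ cong (λ z → n ∸ suc z) (+-comm (t * k) k) ⟩
    n ∸ suc (suc t * k)                ∎
    where
    open ≤-Reasoning
    ∣level∣ = count (level (suc t))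
    witness = count-pos⇒∃ (λ v → suc t <ᵇ d x v) pos
    y = proj₁ witness
    1+t<ᵇdxy = proj₂ witness

  dist-bounded : ∀ y → d x y ≤ n
  dist-bounded y = ≮⇒≥ λ n<dxy → 1+n≰n $ begin
    1                    ≤⟨ ∃⇒count-pos _ y (<⇒<ᵇ n<dxy) ⟩
    above n              ≤⟨ above-bound n ⟩
    n ∸ suc (n * k)      ≡⟨ m≤n⇒m∸n≡0 (m≤n⇒m≤1+n (m≤m*n n k)) ⟩
    0                    ∎
    where open ≤-Reasoning

  status-bound : status d x ≤ sumBelow n (λ t → n ∸ suc (t * k))
  status-bound = begin
    status d x            ≡⟨ layer-cake (d x) n dist-bounded ⟩
    sumBelow n above      ≤⟨ sumBelow-mono n above-bound ⟩
    sumBelow n (λ t → n ∸ suc (t * k)) ∎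
    where open ≤-Reasoning

module PathPower (a k' : ℕ) where

  n k : ℕ
  n = suc a
  k = suc k'

  gap : Fin n → Fin n → ℕ
  gap i j = ∣ toℕ i - toℕ j ∣

  Near : ℕ → Set
  Near g = 1 ≤ g × g ≤ k

  graph : Graph n
  graph = record
    { Adj    = λ i j → Near (gap i j)
    ; sym    = λ {i} {j} → subst Near (∣-∣-comm (toℕ i) (toℕ j))
    ; irrefl = λ {i} (1≤gap , _) → 1+n≰n (subst (1 ≤_) (∣n-n∣≡0 (toℕ i)) 1≤gap)
    }

  dist : Fin n → Fin n → ℕ
  dist i j = ⌈ gap i j /suc k' ⌉

  adj-ascending : ∀ {i j : Fin n} → toℕ i ≤ toℕ j → Near (toℕ j ∸ toℕ i) → Adj graph i j
  adj-ascending i≤j = subst Near (sym (m≤n⇒∣m-n∣≡n∸m i≤j))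

  ascending-walk : ∀ c (i j : Fin n) → toℕ i ≤ toℕ j → ⌈ toℕ j ∸ toℕ i /suc k' ⌉ ≡ c → Walk graph i j c
  ascending-walk zero i j i≤j ⌈D⌉≡0 = subst (λ z → Walk graph i z 0) i≡j (nil tt)
    where
    D≡0 : toℕ j ∸ toℕ i ≡ 0
    D≡0 = n≤0⇒n≡0 (≮⇒≥ λ 0<D → <-irrefl refl (subst (0 <_) ⌈D⌉≡0 (*<⇒<⌈/⌉ {t = 0} k' 0<D)))
    i≡j : i ≡ j
    i≡j = toℕ-injective (≤-antisym i≤j (m∸n≡0⇒m≤n D≡0))
  ascending-walk (suc c) i j i≤j ⌈D⌉≡1+c with toℕ j ∸ toℕ i ≤? k
  ... | yes D≤k = subst (Walk graph i j) 1≡1+c (cons tt (adj-ascending i≤j (0<D , D≤k)) (nil tt))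
    where
    0<D : 0 < toℕ j ∸ toℕ i
    0<D = <⌈/⌉⇒*< {t = 0} k' (subst (0 <_) (sym ⌈D⌉≡1+c) z<s)
    1≡1+c : 1 ≡ suc c
    1≡1+c = ≤-antisym (s≤s z≤n)
      (subst (_≤ 1) ⌈D⌉≡1+c (⌈/⌉-least {l = 1} k' (≤-trans D≤k (≤-reflexive (sym (*-identityˡ k))))))
  ... | no  D≰k = cons tt (adj-ascending i≤i' (subst Near (sym i'-i≡k) (s≤s z≤n , ≤-refl)))
                          (ascending-walk c i' j i'≤j ⌈D-k⌉≡c)
    where
    k≤D : k ≤ toℕ j ∸ toℕ i
    k≤D = <⇒≤ (≰⇒> D≰k)
    i+k≤j : toℕ i + k ≤ toℕ j
    i+k≤j = ≤-trans (+-monoʳ-≤ (toℕ i) k≤D) (≤-reflexive (m+[n∸m]≡n i≤j))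
    i' : Fin n
    i' = fromℕ< (≤-<-trans i+k≤j (toℕ<n j))
    toℕi'≡i+k : toℕ i' ≡ toℕ i + k
    toℕi'≡i+k = toℕ-fromℕ< (≤-<-trans i+k≤j (toℕ<n j))
    i≤i' : toℕ i ≤ toℕ i'
    i≤i' = subst (toℕ i ≤_) (sym toℕi'≡i+k) (m≤m+n (toℕ i) k)
    i'-i≡k : toℕ i' ∸ toℕ i ≡ k
    i'-i≡k = trans (cong (_∸ toℕ i) toℕi'≡i+k) (m+n∸m≡n (toℕ i) k)
    i'≤j : toℕ i' ≤ toℕ j
    i'≤j = subst (_≤ toℕ j) (sym toℕi'≡i+k) i+k≤j
    j-i'≡D-k : toℕ j ∸ toℕ i' ≡ toℕ j ∸ toℕ i ∸ k
    j-i'≡D-k = trans (cong (toℕ j ∸_) toℕi'≡i+k) (sym (∸-+-assoc (toℕ j) (toℕ i) k))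
    ⌈D-k⌉≡c : ⌈ toℕ j ∸ toℕ i' /suc k' ⌉ ≡ c
    ⌈D-k⌉≡c = trans (cong (λ z → ⌈ z /suc k' ⌉) j-i'≡D-k)
                    (suc-injective (trans (sym (⌈/⌉-step k' k≤D)) ⌈D⌉≡1+c))

  shortest-walk : ∀ i j → Walk graph i j (dist i j)
  shortest-walk i j with toℕ i ≤? toℕ j
  ... | yes i≤j = ascending-walk (dist i j) i j i≤j (cong (λ z → ⌈ z /suc k' ⌉) (sym (m≤n⇒∣m-n∣≡n∸m i≤j)))
  ... | no  i≰j =
    walk-reverse (ascending-walk (dist i j) j i j≤i (cong (λ z → ⌈ z /suc k' ⌉) (sym (m≤n⇒∣n-m∣≡n∸m j≤i))))
    where j≤i = <⇒≤ (≰⇒> i≰j)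

  gap-walk : ∀ {P : Fin n → Set} {i j m} → WalkIn graph P i j m → gap i j ≤ m * k
  gap-walk {i = i} (nil _) = ≤-reflexive (∣n-n∣≡0 (toℕ i))
  gap-walk {i = i} {j} (cons {y = w} _ (_ , gap≤k) walk) =
    ≤-trans (∣-∣-triangle (toℕ i) (toℕ w) (toℕ j)) (+-mono-≤ gap≤k (gap-walk walk))

  dist-isDistance : IsDistance graph dist
  dist-isDistance i j = shortest-walk i j , λ m walk → ⌈/⌉-least k' (gap-walk walk)

  module _ (S : Subset n) (∣S∣≡k' : ∣ S ∣ ≡ k') where

    free-in-window : ∀ i → i + k < n → ∃ λ z → i < toℕ z × toℕ z ≤ i + k × z ∉ S
    free-in-window i i+k<n =
      z , <ᵇ⇒< i (toℕ z) i<ᵇz , ≮⇒≥ (T-not⇒¬T z≤ᵇi+k ∘ <⇒<ᵇ) , T-not⇒¬T z∉S ∘ ∈⇒T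
      where
      window : Fin n → Bool
      window y = (i <ᵇ toℕ y) ∧ not (i + k <ᵇ toℕ y)
      ∣S∣<∣window∣ : count (λ y → does (y ∈? S)) < count window
      ∣S∣<∣window∣ = begin-strict
        count (λ y → does (y ∈? S)) ≡⟨ sym (∣S∣≡count S) ⟩
        ∣ S ∣                        ≡⟨ ∣S∣≡k' ⟩
        k'                           <⟨ n<1+n k' ⟩
        k                            ≡⟨ sym (count-window i k i+k<n) ⟩
        count window                 ∎
        where open ≤-Reasoning
      excess = count-excess window (λ y → does (y ∈? S)) ∣S∣<∣window∣
      z = proj₁ excess
      z∈window = Equivalence.to (T-∧ {i <ᵇ toℕ z}) (proj₁ (proj₂ excess))
      i<ᵇz = proj₁ z∈window
      z≤ᵇi+k = proj₂ z∈window
      z∉S = proj₂ (proj₂ excess)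

    ascending-path : ∀ fuel (i j : Fin n) → toℕ j ∸ toℕ i < fuel → toℕ i ≤ toℕ j → i ∉ S → j ∉ S →
      ∃ λ m → WalkIn graph (_∉ S) i j m
    ascending-path (suc fuel) i j D<fuel i≤j i∉S j∉S with toℕ j ∸ toℕ i ≤? k | toℕ i ≟ℕ toℕ j
    ... | _       | yes i≡j = 0 , subst (λ z → WalkIn graph (_∉ S) i z 0) (toℕ-injective i≡j) (nil i∉S)
    ... | yes D≤k | no  i≢j = 1 , cons i∉S (adj-ascending i≤j (m<n⇒0<n∸m (≤∧≢⇒< i≤j i≢j) , D≤k)) (nil j∉S)
    ... | no  D≰k | no  _   =
      let m , walk = ascending-path fuel z j (≤-trans (∸-monoʳ-< i<z z≤j) (s≤s⁻¹ D<fuel)) z≤j z∉S j∉S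
      in suc m , cons i∉S i~z walk
      where
      i+k<j : toℕ i + k < toℕ j
      i+k<j = ≤-trans (+-monoʳ-< (toℕ i) (≰⇒> D≰k)) (≤-reflexive (m+[n∸m]≡n i≤j))
      free = free-in-window (toℕ i) (<-trans i+k<j (toℕ<n j))
      z = proj₁ free
      i<z = proj₁ (proj₂ free)
      z≤i+k = proj₁ (proj₂ (proj₂ free))
      z∉S = proj₂ (proj₂ (proj₂ free))
      z≤j : toℕ z ≤ toℕ j
      z≤j = <⇒≤ (≤-<-trans z≤i+k i+k<j)
      i~z : Adj graph i z
      i~z = adj-ascending (<⇒≤ i<z)
              (m<n⇒0<n∸m i<z , subst (toℕ z ∸ toℕ i ≤_) (m+n∸m≡n (toℕ i) k) (∸-monoˡ-≤ (toℕ i) z≤i+k))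

    connected-avoiding : ConnectedAvoiding graph S
    connected-avoiding i j i∉S j∉S with toℕ i ≤? toℕ j
    ... | yes i≤j = ascending-path (suc (toℕ j ∸ toℕ i)) i j ≤-refl i≤j i∉S j∉S
    ... | no  i≰j =
      let m , walk = ascending-path (suc (toℕ i ∸ toℕ j)) j i ≤-refl (<⇒≤ (≰⇒> i≰j)) j∉S i∉S
      in m , walk-reverse walk

  k-connected : suc k' < a → KConnected k graph
  k-connected k<a = (λ i j → dist i j , shortest-walk i j)
                  , ≤-trans (≤-reflexive (+-comm k' 2)) (m≤n⇒m≤1+n k<a)
                  , connected-avoiding

  status-first : status dist zero ≡ sumBelow n (λ t → n ∸ suc (t * k))
  status-first = begin
    status dist zero                                          ≡⟨ layer-cake ⌈y/k⌉ n ⌈y/k⌉≤n ⟩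
    sumBelow n (λ t → count (λ y → t <ᵇ ⌈y/k⌉ y))             ≡⟨ sumBelow-cong n (λ t → count-cong (⇒k* t) (k*⇒ t)) ⟩
    sumBelow n (λ t → count {n} (λ y → t * k <ᵇ toℕ y))       ≡⟨ sumBelow-cong n (λ t → count-toℕ> n (t * k)) ⟩
    sumBelow n (λ t → n ∸ suc (t * k))                        ∎
    where
    open ≡-Reasoning
    ⌈y/k⌉ : Fin n → ℕ
    ⌈y/k⌉ y = ⌈ toℕ y /suc k' ⌉
    ⌈y/k⌉≤n : ∀ y → ⌈y/k⌉ y ≤ n
    ⌈y/k⌉≤n y = ≤-trans (⌈/⌉-least k' (m≤m*n (toℕ y) k)) (<⇒≤ (toℕ<n y))
    ⇒k* : ∀ t y → T (t <ᵇ ⌈y/k⌉ y) → T (t * k <ᵇ toℕ y)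
    ⇒k* t y = <⇒<ᵇ ∘ <⌈/⌉⇒*< {toℕ y} k' ∘ <ᵇ⇒< t (⌈y/k⌉ y)
    k*⇒ : ∀ t y → T (t * k <ᵇ toℕ y) → T (t <ᵇ ⌈y/k⌉ y)
    k*⇒ t y = <⇒<ᵇ ∘ *<⇒<⌈/⌉ {toℕ y} k' ∘ <ᵇ⇒< (t * k) (toℕ y)

theorem4p2 : (n k' : ℕ) → suc k' < n ∸ 1 →
    ((G : Graph n) → KConnected (suc k') G → (d : Fin n → Fin n → ℕ) → IsDistance G d →
      (x : Fin n) → 2 * status d x ≤ twiceBound n k')
    × ((k' ≡ 0 ⊎ (∃ λ j → suc k' ≡ 2 * suc j)) →
      Σ (Graph n) λ G → KConnected (suc k') G × (∃ λ d → IsDistance G d × (∃ λ x → 2 * status d x ≡ twiceBound n k')))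
theorem4p2 zero    k' ()
theorem4p2 (suc a) k' k<a = upper-bound , λ _ → extremal
  where
  upper-bound : (G : Graph (suc a)) → KConnected (suc k') G → (d : Fin (suc a) → Fin (suc a) → ℕ) →
    IsDistance G d → (x : Fin (suc a)) → 2 * status d x ≤ twiceBound (suc a) k'
  upper-bound G k-conn d d-dist x = begin
    2 * status d x                              ≤⟨ *-monoʳ-≤ 2 (StatusBound.status-bound G k' k-conn d d-dist x) ⟩
    2 * sumBelow (suc a) (λ t → a ∸ t * suc k') ≡⟨ sym (twiceBound≡sumBelow a k') ⟩
    twiceBound (suc a) k'                       ∎
    where open ≤-Reasoning

  open PathPower a k'

  -- The path power is extremal for every k.
  extremal : Σ (Graph (suc a)) λ G → KConnected (suc k') G ×
    (∃ λ d → IsDistance G d × (∃ λ x → 2 * status d x ≡ twiceBound (suc a) k'))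
  extremal = graph , k-connected k<a , dist , dist-isDistance , zero ,
             trans (cong (2 *_) status-first) (sym (twiceBound≡sumBelow a k'))
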